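{- For every finite digraph $A$ and all positive integers $n,m$, \[\hom(A, m\cdot \mathsf{C}_n)=\begin{cases}0 & \text{if } n\nmid \gamma(A),\\ (m\cdot n)^{c(A)} & \text{if } n\mid\gamma(A).\end{cases}\]
   Context: A digraph is a pair $(V,R)$ with $V$ a finite non-empty set and $R\subseteq V\times V$; $\hom(A,B)$ is the number of homomorphisms (edge-preserving maps) from $A$ to $B$. $\mathsf{C}_n$ is the directed cycle with vertices $\{0,\dots,n-1\}$ and edges $(i,i+1)$ for $i<n-1$ and $(n-1,0)$. $m\cdot H$ denotes the disjoint union of $m$ copies of $H$. $c(A)$ is the number of connected components of $A$ (connectivity ignoring edge directions; isolated vertices are components). An oriented walk in $A$ is a sequence $(a_0,r_0,a_1,\dots,a_n,r_n,a_{n+1})$ with $r_i\in\{+,-\}$, where $r_i=+$ requires $(a_i,a_{i+1})\in R$ and $r_i=-$ requires $(a_{i+1},a_i)\in R$; its net length is $\#\{i:r_i=+\}-\#\{i:r_i=-\}$. A closed oriented walk $(a_0,r_0,\dots,a_n,r_n,a_0)$ with $n\ge0$ and $a_0,\dots,a_n$ pairwise distinct is an oriented cycle. $\gamma(A)$ is the gcd of the net lengths of all oriented cycles of positive net length in $A$, with $\gcd(\varnothing)=0$. -}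

module Defs where

open import Data.Nat using (ℕ; zero; suc; _+_; _*_; _∸_; _≤_; _≡ᵇ_; NonZero)
open import Data.Nat.Properties using (m*n≢0)
open import Data.Nat.Divisibility using (_∣_)
open import Data.Integer as ℤ using (ℤ; +_)
open import Data.Bool using (Bool; true; false; _∧_; _∨_; T)
open import Data.Fin as Fin using (Fin; toℕ; remQuot)
open import Data.Fin.Properties using (all?)
open import Data.Product using (Σ; ∃; _×_; _,_; proj₁; proj₂)
open import Data.List using (List; allFin; []; _∷_; [_]; map; concatMap; length; filter)
open import Data.List.Relation.Unary.Unique.Propositional using (Unique)
open import Data.Vec.Functional as VF using ()
open import Function.Bundles using (_⇔_)
open import Relation.Binary.PropositionalEquality using (_≡_)
open import Relation.Nullary.Decidable using (Dec; ⌊_⌋; _→-dec_; _×-dec_)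
open import Relation.Nullary using (¬_)

record Digraph : Set where
  field
    size     : ℕ
    nonEmpty : NonZero size
    edge     : Fin size → Fin size → Bool

open Digraph public

V : Digraph → Set
V A = Fin (size A)

Edge : (A : Digraph) → V A → V A → Set
Edge A u v = T (edge A u v)

-- The directed cycle C_n on {0,…,n-1}: edges (i,i+1) for i < n-1, and (n-1,0).
cycle : (n : ℕ) → {{nz : NonZero n}} → Digraph
cycle n {{nz}} = record
  { size = n
  ; nonEmpty = nz
  ; edge = λ i j →
      (toℕ j ≡ᵇ suc (toℕ i))
      ∨ ((toℕ i ≡ᵇ (n ∸ 1)) ∧ (toℕ j ≡ᵇ 0))
  }

-- m · H : disjoint union of m copies of H.  Vertex set Fin (m * |H|),
-- a vertex x encodes the pair remQuot x = (copy index, vertex of H).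
copies : (m : ℕ) → {{nz : NonZero m}} → Digraph → Digraph
copies m {{nz}} H = record
  { size = m * size H
  ; nonEmpty = m*n≢0 m (size H) {{nz}} {{nonEmpty H}}
  ; edge = λ x y →
      let (i , a) = remQuot {m} (size H) x
          (j , b) = remQuot {m} (size H) y
      in ⌊ i Fin.≟ j ⌋ ∧ edge H a b
  }

IsHom : (A B : Digraph) → (V A → V B) → Set
IsHom A B f = ∀ u v → Edge A u v → Edge B (f u) (f v)

isHom? : (A B : Digraph) → (f : V A → V B) → Dec (IsHom A B f)
isHom? A B f = all? λ u → all? λ v →
  Data.Bool.Properties.T? (edge A u v) →-dec Data.Bool.Properties.T? (edge B (f u) (f v))
  where import Data.Bool.Properties

allFuns : (a b : ℕ) → List (Fin a → Fin b)
allFuns zero    b = [ (λ ()) ]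
allFuns (suc a) b =
  concatMap (λ x → map (λ f → x VF.∷ f) (allFuns a b)) (allFin b)

hom : Digraph → Digraph → ℕ
hom A B = length (filter (isHom? A B) (allFuns (size A) (size B)))

data Walk (A : Digraph) : V A → V A → Set where
  []   : ∀ {a} → Walk A a a
  _+∷_ : ∀ {a b c} → Edge A a b → Walk A b c → Walk A a c
  _-∷_ : ∀ {a b c} → Edge A b a → Walk A b c → Walk A a c

steps : ∀ {A a b} → Walk A a b → ℕ
steps []       = 0
steps (_ +∷ w) = suc (steps w)
steps (_ -∷ w) = suc (steps w)

netLength : ∀ {A a b} → Walk A a b → ℤ
netLength []       = + 0
netLength (_ +∷ w) = ℤ.suc (netLength w)
netLength (_ -∷ w) = ℤ.pred (netLength w)

-- the vertices a_0, …, a_n at which the steps start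
-- (for a closed walk this omits only the final return to a_0)
startVertices : ∀ {A a b} → Walk A a b → List (V A)
startVertices []                 = []
startVertices {a = a} (_ +∷ w)   = a ∷ startVertices w
startVertices {a = a} (_ -∷ w)   = a ∷ startVertices w

-- An oriented cycle: a closed oriented walk (a_0,r_0,…,a_n,r_n,a_0), n ≥ 0,
-- with a_0,…,a_n pairwise distinct.
record OrientedCycle (A : Digraph) : Set where
  field
    base     : V A
    walk     : Walk A base base
    nonTriv  : 1 ≤ steps walk
    distinct : Unique (startVertices walk)

-- γ(A) = g : g is the gcd of the net lengths of all oriented cycles of
-- positive net length (gcd characterised by its universal property in
-- the divisibility order; gcd(∅) = 0).
IsGamma : Digraph → ℕ → Set
IsGamma A g =
  (∀ (C : OrientedCycle A) (k : ℕ) → netLength (OrientedCycle.walk C) ≡ + suc k → g ∣ suc k)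
  × (∀ d → (∀ (C : OrientedCycle A) (k : ℕ) → netLength (OrientedCycle.walk C) ≡ + suc k → d ∣ suc k)
         → d ∣ g)

Connected : (A : Digraph) → V A → V A → Set
Connected A u v = Walk A u v

-- c(A) = k : the components are in bijection with Fin k, i.e. there is a
-- surjective labelling of vertices by Fin k whose fibres are exactly the
-- connected components.
IsComponentCount : Digraph → ℕ → Set
IsComponentCount A k =
  Σ (V A → Fin k) λ lbl →
    (∀ (i : Fin k) → ∃ λ v → lbl v ≡ i)
    × (∀ u v → (lbl u ≡ lbl v) ⇔ Connected A u v)

{-# OPTIONS --safe #-}
-- A homomorphism f : A → m · Cₙ keeps each component of A inside one copy of Cₙ, and along an
-- oriented walk W from u to v the position of f v on its cycle is that of f u shifted by the net
-- length of W, modulo n.  Applied to oriented cycles, a homomorphism forces n ∣ γ(A).  Conversely,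
-- a closed walk splits into oriented cycles, so if n ∣ γ(A) every closed walk has net length
-- ≡ 0 (mod n); net lengths mod n are then path-independent, and a homomorphism is freely and
-- uniquely determined by the images of one representative per component: (m n)^c(A) of them.
module Submission where

open import Defs
open import Data.Nat using (ℕ; _*_; _^_; NonZero)
open import Data.Nat.Divisibility using (_∣_; _∤_)
open import Data.Product using (_×_)
open import Relation.Binary.PropositionalEquality using (_≡_)
open import Data.Product using (_,_)

module Counting where

  open import Data.Bool.Base using (true; false; if_then_else_)
  open import Data.Nat.Base using (ℕ; zero; suc; _+_; _*_; _^_)
  import Data.Nat.Properties as ℕ
  open import Algebra.Properties.CommutativeSemigroup ℕ.+-commutativeSemigroup using (interchange)
  open import Data.Fin.Base using (Fin; zero; suc)
  open import Data.Fin.Properties using (_≟_; all?)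
  open import Data.List.Base using (List; []; _∷_; _++_; map; concatMap; length; filter; allFin; tabulate)
  import Data.List.Properties as List
  open import Data.Product.Base using (_×_; _,_)
  import Data.Vec.Functional as VF
  open import Function.Base using (_∘_)
  open import Function.Bundles using (_⇔_; mk⇔; Equivalence)
  open import Relation.Nullary.Decidable using (Dec; yes; no; does; _×-dec_)
  open import Relation.Unary using (Pred; Decidable)
  open import Relation.Binary.PropositionalEquality
    using (_≡_; _≗_; refl; sym; trans; cong; cong₂; module ≡-Reasoning)

  𝟙 : ∀ {p} {P : Set p} → Dec P → ℕ
  𝟙 P? = if does P? then 1 else 0

  𝟙-cong : ∀ {p q} {P : Set p} {Q : Set q} → P ⇔ Q → (P? : Dec P) (Q? : Dec Q) → 𝟙 P? ≡ 𝟙 Q?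
  𝟙-cong P⇔Q (yes _) (yes _) = refl
  𝟙-cong P⇔Q (yes p) (no ¬q) with () ← ¬q (Equivalence.to P⇔Q p)
  𝟙-cong P⇔Q (no ¬p) (yes q) with () ← ¬p (Equivalence.from P⇔Q q)
  𝟙-cong P⇔Q (no _)  (no _)  = refl

  𝟙-× : ∀ {p q} {P : Set p} {Q : Set q} (P? : Dec P) (Q? : Dec Q) → 𝟙 (P? ×-dec Q?) ≡ 𝟙 P? * 𝟙 Q?
  𝟙-× (yes _) (yes _) = refl
  𝟙-× (yes _) (no _)  = refl
  𝟙-× (no _)  _       = refl

  ∑ : ∀ {a} {X : Set a} → List X → (X → ℕ) → ℕ
  ∑ []       f = 0
  ∑ (x ∷ xs) f = f x + ∑ xs f

  infix 5 ∑
  syntax ∑ xs (λ x → e) = ∑[ x ∈ xs ] e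

  module _ {a} {X : Set a} where

    ∑-cong : ∀ (xs : List X) {f g : X → ℕ} → f ≗ g → ∑ xs f ≡ ∑ xs g
    ∑-cong []       f≗g = refl
    ∑-cong (x ∷ xs) f≗g = cong₂ _+_ (f≗g x) (∑-cong xs f≗g)

    ∑-++ : ∀ (xs ys : List X) f → ∑ (xs ++ ys) f ≡ ∑ xs f + ∑ ys f
    ∑-++ []       ys f = refl
    ∑-++ (x ∷ xs) ys f = trans (cong (f x +_) (∑-++ xs ys f)) (sym (ℕ.+-assoc (f x) _ _))

    ∑-map : ∀ {b} {Y : Set b} (g : Y → X) (ys : List Y) f → ∑ (map g ys) f ≡ ∑ ys (f ∘ g)
    ∑-map g []       f = refl
    ∑-map g (y ∷ ys) f = cong (f (g y) +_) (∑-map g ys f)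

    ∑-+ : ∀ (xs : List X) f g → ∑[ x ∈ xs ] (f x + g x) ≡ ∑ xs f + ∑ xs g
    ∑-+ []       f g = refl
    ∑-+ (x ∷ xs) f g = trans (cong (f x + g x +_) (∑-+ xs f g)) (interchange (f x) (g x) (∑ xs f) (∑ xs g))

    ∑-*ˡ : ∀ (xs : List X) c f → ∑[ x ∈ xs ] (c * f x) ≡ c * ∑ xs f
    ∑-*ˡ []       c f = sym (ℕ.*-zeroʳ c)
    ∑-*ˡ (x ∷ xs) c f = trans (cong (c * f x +_) (∑-*ˡ xs c f)) (sym (ℕ.*-distribˡ-+ c (f x) _))

    ∑-zero : ∀ (xs : List X) → ∑[ _ ∈ xs ] 0 ≡ 0
    ∑-zero []       = refl
    ∑-zero (x ∷ xs) = ∑-zero xs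

    ∑-const : ∀ (xs : List X) c → ∑[ _ ∈ xs ] c ≡ length xs * c
    ∑-const []       c = refl
    ∑-const (x ∷ xs) c = cong (c +_) (∑-const xs c)

  ∑-swap : ∀ {a b} {X : Set a} {Y : Set b} (xs : List X) (ys : List Y) (f : X → Y → ℕ) →
           ∑[ x ∈ xs ] ∑[ y ∈ ys ] f x y ≡ ∑[ y ∈ ys ] ∑[ x ∈ xs ] f x y
  ∑-swap []       ys f = sym (∑-zero ys)
  ∑-swap (x ∷ xs) ys f = trans (cong (∑ ys (f x) +_) (∑-swap xs ys f)) (sym (∑-+ ys (f x) _))

  ∑-allFin-suc : ∀ n (f : Fin (suc n) → ℕ) → ∑ (allFin (suc n)) f ≡ f zero + (∑[ i ∈ allFin n ] f (suc i))
  ∑-allFin-suc n f = cong (f zero +_) (begin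
    ∑ (tabulate suc) f          ≡⟨ cong (λ is → ∑ is f) (List.map-tabulate (λ i → i) suc) ⟨
    ∑ (map suc (allFin n)) f    ≡⟨ ∑-map suc (allFin n) f ⟩
    ∑[ i ∈ allFin n ] f (suc i) ∎)
    where open ≡-Reasoning

  ∑-allFin-≟ : ∀ {n} (j : Fin n) → ∑[ i ∈ allFin n ] 𝟙 (i ≟ j) ≡ 1
  ∑-allFin-≟ {suc n} zero    = trans (∑-allFin-suc n (λ i → 𝟙 (i ≟ zero))) (cong suc (∑-zero (allFin n)))
  ∑-allFin-≟ {suc n} (suc j) = trans (∑-allFin-suc n (λ i → 𝟙 (i ≟ suc j))) (∑-allFin-≟ j)

  ∑-allFuns-suc : ∀ a b (F : (Fin (suc a) → Fin b) → ℕ) →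
                  ∑ (allFuns (suc a) b) F ≡ ∑[ x ∈ allFin b ] ∑[ f ∈ allFuns a b ] F (x VF.∷ f)
  ∑-allFuns-suc a b F = go (allFin b)
    where
    go : ∀ xs → ∑ (concatMap (λ x → map (x VF.∷_) (allFuns a b)) xs) F ≡
                ∑[ x ∈ xs ] ∑[ f ∈ allFuns a b ] F (x VF.∷ f)
    go []       = refl
    go (x ∷ xs) = trans (∑-++ (map (x VF.∷_) (allFuns a b)) _ F)
                        (cong₂ _+_ (∑-map (x VF.∷_) (allFuns a b) F) (go xs))

  -- Without function extensionality functions are compared pointwise: "allFuns a b lists every
  -- function exactly once" becomes ∑-allFuns-≗ below.
  infix 4 _≗?_
  _≗?_ : ∀ {a b} (f g : Fin a → Fin b) → Dec (f ≗ g)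
  f ≗? g = all? (λ i → f i ≟ g i)

  𝟙-∷-≗ : ∀ {a b} (x : Fin b) (f : Fin a → Fin b) (g : Fin (suc a) → Fin b) →
          𝟙 (x VF.∷ f ≗? g) ≡ 𝟙 (x ≟ g zero) * 𝟙 (f ≗? g ∘ suc)
  𝟙-∷-≗ x f g = trans (𝟙-cong ∷-≗⇔ (x VF.∷ f ≗? g) (x ≟ g zero ×-dec f ≗? g ∘ suc))
                      (𝟙-× (x ≟ g zero) (f ≗? g ∘ suc))
    where
    ∷-≗⇔ : (x VF.∷ f ≗ g) ⇔ (x ≡ g zero × f ≗ g ∘ suc)
    ∷-≗⇔ = mk⇔ (λ eq → eq zero , eq ∘ suc) λ where
      (x≡ , f≗) zero    → x≡
      (x≡ , f≗) (suc i) → f≗ i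

  ∑-allFuns-≗ : ∀ a b (g : Fin a → Fin b) → ∑[ f ∈ allFuns a b ] 𝟙 (f ≗? g) ≡ 1
  ∑-allFuns-≗ zero    b g = refl
  ∑-allFuns-≗ (suc a) b g = begin
    ∑[ f ∈ allFuns (suc a) b ] 𝟙 (f ≗? g)
      ≡⟨ ∑-allFuns-suc a b (λ f → 𝟙 (f ≗? g)) ⟩
    ∑[ x ∈ allFin b ] ∑[ f ∈ allFuns a b ] 𝟙 (x VF.∷ f ≗? g)
      ≡⟨ ∑-cong (allFin b) (λ x → ∑-cong (allFuns a b) (λ f → 𝟙-∷-≗ x f g)) ⟩
    ∑[ x ∈ allFin b ] ∑[ f ∈ allFuns a b ] (𝟙 (x ≟ g zero) * 𝟙 (f ≗? g ∘ suc))
      ≡⟨ ∑-cong (allFin b) (λ x → ∑-*ˡ (allFuns a b) (𝟙 (x ≟ g zero)) (λ f → 𝟙 (f ≗? g ∘ suc))) ⟩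
    ∑[ x ∈ allFin b ] (𝟙 (x ≟ g zero) * (∑[ f ∈ allFuns a b ] 𝟙 (f ≗? g ∘ suc)))
      ≡⟨ ∑-cong (allFin b) (λ x → cong (𝟙 (x ≟ g zero) *_) (∑-allFuns-≗ a b (g ∘ suc))) ⟩
    ∑[ x ∈ allFin b ] (𝟙 (x ≟ g zero) * 1)
      ≡⟨ ∑-cong (allFin b) (λ x → ℕ.*-identityʳ (𝟙 (x ≟ g zero))) ⟩
    ∑[ x ∈ allFin b ] 𝟙 (x ≟ g zero)
      ≡⟨ ∑-allFin-≟ (g zero) ⟩
    1 ∎
    where open ≡-Reasoning

  ∑-allFuns-1 : ∀ a b → ∑[ _ ∈ allFuns a b ] 1 ≡ b ^ a
  ∑-allFuns-1 zero    b = refl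
  ∑-allFuns-1 (suc a) b = begin
    ∑[ _ ∈ allFuns (suc a) b ] 1              ≡⟨ ∑-allFuns-suc a b (λ _ → 1) ⟩
    ∑[ _ ∈ allFin b ] ∑[ _ ∈ allFuns a b ] 1  ≡⟨ ∑-cong (allFin b) (λ _ → ∑-allFuns-1 a b) ⟩
    ∑[ _ ∈ allFin b ] b ^ a                   ≡⟨ ∑-const (allFin b) (b ^ a) ⟩
    length (allFin b) * b ^ a                 ≡⟨ cong (_* b ^ a) (List.length-tabulate {n = b} (λ i → i)) ⟩
    b * b ^ a                                 ∎
    where open ≡-Reasoning

  length-filter≡∑𝟙 : ∀ {a p} {X : Set a} {P : Pred X p} (P? : Decidable P) (xs : List X) →
                     length (filter P? xs) ≡ ∑[ x ∈ xs ] 𝟙 (P? x)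
  length-filter≡∑𝟙 P? []       = refl
  length-filter≡∑𝟙 P? (x ∷ xs) with does (P? x)
  ... | true  = cong suc (length-filter≡∑𝟙 P? xs)
  ... | false = length-filter≡∑𝟙 P? xs

  -- Up to ≗, restriction along rep is a bijection from the functions satisfying P onto
  -- Fin k → Fin b, with inverse ext.
  module _ {a b k p} {P : Pred (Fin a → Fin b) p} (P? : Decidable P)
           (rep : Fin k → Fin a) (ext : (Fin k → Fin b) → Fin a → Fin b)
           (P-resp-≗ : ∀ {f g} → f ≗ g → P f → P g)
           (ext-cong : ∀ {c d} → c ≗ d → ext c ≗ ext d)
           (P-ext : ∀ c → P (ext c))
           (ext-rep : ∀ c → ext c ∘ rep ≗ c)
           (P⇒≗ext : ∀ {f} → P f → f ≗ ext (f ∘ rep))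
           where

    private
      𝟙-restricts : ∀ f c → 𝟙 (P? f) * 𝟙 (c ≗? f ∘ rep) ≡ 𝟙 (f ≗? ext c)
      𝟙-restricts f c = trans (sym (𝟙-× (P? f) (c ≗? f ∘ rep)))
                              (𝟙-cong restricts⇔ (P? f ×-dec c ≗? f ∘ rep) (f ≗? ext c))
        where
        restricts⇔ : (P f × c ≗ f ∘ rep) ⇔ (f ≗ ext c)
        restricts⇔ = mk⇔
          (λ (Pf , c≗) i → trans (P⇒≗ext Pf i) (ext-cong (λ j → sym (c≗ j)) i))
          (λ f≗ → P-resp-≗ (λ i → sym (f≗ i)) (P-ext c) , λ j → sym (trans (f≗ (rep j)) (ext-rep c j)))

    length-filter-parametrised : length (filter P? (allFuns a b)) ≡ b ^ k
    length-filter-parametrised = begin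
      length (filter P? Fs)
        ≡⟨ length-filter≡∑𝟙 P? Fs ⟩
      ∑[ f ∈ Fs ] 𝟙 (P? f)
        ≡⟨ ∑-cong Fs (λ f → ℕ.*-identityʳ (𝟙 (P? f))) ⟨
      ∑[ f ∈ Fs ] (𝟙 (P? f) * 1)
        ≡⟨ ∑-cong Fs (λ f → cong (𝟙 (P? f) *_) (∑-allFuns-≗ k b (f ∘ rep))) ⟨
      ∑[ f ∈ Fs ] (𝟙 (P? f) * (∑[ c ∈ Cs ] 𝟙 (c ≗? f ∘ rep)))
        ≡⟨ ∑-cong Fs (λ f → ∑-*ˡ Cs (𝟙 (P? f)) (λ c → 𝟙 (c ≗? f ∘ rep))) ⟨
      ∑[ f ∈ Fs ] ∑[ c ∈ Cs ] (𝟙 (P? f) * 𝟙 (c ≗? f ∘ rep))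
        ≡⟨ ∑-swap Fs Cs (λ f c → 𝟙 (P? f) * 𝟙 (c ≗? f ∘ rep)) ⟩
      ∑[ c ∈ Cs ] ∑[ f ∈ Fs ] (𝟙 (P? f) * 𝟙 (c ≗? f ∘ rep))
        ≡⟨ ∑-cong Cs (λ c → ∑-cong Fs (λ f → 𝟙-restricts f c)) ⟩
      ∑[ c ∈ Cs ] ∑[ f ∈ Fs ] 𝟙 (f ≗? ext c)
        ≡⟨ ∑-cong Cs (λ c → ∑-allFuns-≗ a b (ext c)) ⟩
      ∑[ c ∈ Cs ] 1
        ≡⟨ ∑-allFuns-1 k b ⟩
      b ^ k ∎
      where
      open ≡-Reasoning
      Fs = allFuns a b
      Cs = allFuns k b

module Congruence where

  open import Data.Nat.Base using (ℕ; zero; suc; _∸_; _<_; _≤_)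
  import Data.Nat.Properties as ℕ
  open import Data.Nat.Divisibility using (_∣_; >⇒∤)
  open import Data.Integer.Base using (ℤ; +_; _+_; _-_; -_; 0ℤ; ∣_∣)
  import Data.Integer.Properties as ℤ
  open import Data.Integer.Divisibility.Signed as ℤ∣ using (divides; ∣ᵤ⇒∣; ∣⇒∣ᵤ)
    renaming (_∣_ to _∣ᶻ_)
  open import Data.Integer.Tactic.RingSolver using (solve-∀)
  open import Data.Sum.Base using (inj₁; inj₂)
  open import Relation.Binary.Bundles using (Setoid)
  open import Relation.Binary.Structures using (IsEquivalence)
  open import Relation.Binary.PropositionalEquality using (_≡_; refl; sym; trans; cong; subst)
  open import Relation.Nullary.Negation using (contradiction)

  private
    a-b≡-[b-a] : ∀ a b → a - b ≡ - (b - a)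
    a-b≡-[b-a] = solve-∀

    [a-b]+[b-c]≡a-c : ∀ a b c → (a - b) + (b - c) ≡ a - c
    [a-b]+[b-c]≡a-c = solve-∀

    [a+c]-[b+d]≡[a-b]+[c-d] : ∀ a b c d → (a + c) - (b + d) ≡ (a - b) + (c - d)
    [a+c]-[b+d]≡[a-b]+[c-d] = solve-∀

    [a+i]-a≡i-0 : ∀ a i → (a + i) - a ≡ i - 0ℤ
    [a+i]-a≡i-0 = solve-∀

  -- A record rather than a synonym for + n ∣ a - b, so that a and b can be inferred.
  infix 4 _≡_mod_
  record _≡_mod_ (a b : ℤ) (n : ℕ) : Set where
    constructor mod∣
    field divides-difference : + n ∣ᶻ a - b

  module _ {n : ℕ} where

    ≡-mod-reflexive : ∀ {a b} → a ≡ b → a ≡ b mod n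
    ≡-mod-reflexive {a} refl = mod∣ (divides 0ℤ (trans (ℤ.+-inverseʳ a) (sym (ℤ.*-zeroˡ (+ n)))))

    ≡-mod-sym : ∀ {a b} → a ≡ b mod n → b ≡ a mod n
    ≡-mod-sym {a} {b} (mod∣ n∣a-b) = mod∣ (subst (+ n ∣ᶻ_) (sym (a-b≡-[b-a] b a)) (ℤ∣.∣m⇒∣-m n∣a-b))

    ≡-mod-trans : ∀ {a b c} → a ≡ b mod n → b ≡ c mod n → a ≡ c mod n
    ≡-mod-trans {a} {b} {c} (mod∣ n∣a-b) (mod∣ n∣b-c) =
      mod∣ (subst (+ n ∣ᶻ_) ([a-b]+[b-c]≡a-c a b c) (ℤ∣.∣m∣n⇒∣m+n n∣a-b n∣b-c))

    +-cong-mod : ∀ {a b c d} → a ≡ b mod n → c ≡ d mod n → a + c ≡ b + d mod n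
    +-cong-mod {a} {b} {c} {d} (mod∣ n∣a-b) (mod∣ n∣c-d) =
      mod∣ (subst (+ n ∣ᶻ_) (sym ([a+c]-[b+d]≡[a-b]+[c-d] a b c d)) (ℤ∣.∣m∣n⇒∣m+n n∣a-b n∣c-d))

    +-congˡ-mod : ∀ a {c d} → c ≡ d mod n → a + c ≡ a + d mod n
    +-congˡ-mod a = +-cong-mod (≡-mod-reflexive {a} refl)

    +-congʳ-mod : ∀ {a b} c → a ≡ b mod n → a + c ≡ b + c mod n
    +-congʳ-mod c a≡b = +-cong-mod a≡b (≡-mod-reflexive {c} refl)

    a-b≡0⇒a≡b : ∀ {a b} → a - b ≡ 0ℤ mod n → a ≡ b mod n
    a-b≡0⇒a≡b {a} {b} (mod∣ n∣a-b-0) = mod∣ (subst (+ n ∣ᶻ_) (ℤ.+-identityʳ (a - b)) n∣a-b-0)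

    +-cancelˡ-mod : ∀ {a i} → a ≡ a + i mod n → i ≡ 0ℤ mod n
    +-cancelˡ-mod {a} {i} a≡a+i =
      mod∣ (subst (+ n ∣ᶻ_) ([a+i]-a≡i-0 a i) (_≡_mod_.divides-difference (≡-mod-sym a≡a+i)))

    ∣∣⇒≡0-mod : ∀ {i} → n ∣ ∣ i ∣ → i ≡ 0ℤ mod n
    ∣∣⇒≡0-mod {i} n∣i = mod∣ (subst (+ n ∣ᶻ_) (sym (ℤ.+-identityʳ i)) (∣ᵤ⇒∣ n∣i))

    ≡0-mod⇒∣ : ∀ {k} → + k ≡ 0ℤ mod n → n ∣ k
    ≡0-mod⇒∣ {k} (mod∣ n∣k-0) = subst (n ∣_) (cong ∣_∣ (ℤ.+-identityʳ (+ k))) (∣⇒∣ᵤ n∣k-0)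

    ≡-mod-∣ : ∀ {d a b} → d ∣ n → a ≡ b mod n → a ≡ b mod d
    ≡-mod-∣ d∣n (mod∣ n∣a-b) = mod∣ (ℤ∣.∣-trans (∣ᵤ⇒∣ d∣n) n∣a-b)

    ≡-mod-isEquivalence : IsEquivalence (_≡_mod n)
    ≡-mod-isEquivalence = record { refl = ≡-mod-reflexive refl ; sym = ≡-mod-sym ; trans = ≡-mod-trans }

  ℤ-mod : ℕ → Setoid _ _
  ℤ-mod n = record { isEquivalence = ≡-mod-isEquivalence {n} }

  private
    ∣-<⇒≡0 : ∀ {n m} → n ∣ m → m < n → m ≡ 0
    ∣-<⇒≡0 {m = zero}  _   _   = refl
    ∣-<⇒≡0 {m = suc m} n∣m m<n = contradiction n∣m (>⇒∤ m<n)

    ≤-<-mod-injective : ∀ {n x y} → x ≤ y → y < n → + x ≡ + y mod n → x ≡ y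
    ≤-<-mod-injective {n} {x} {y} x≤y y<n (mod∣ n∣x-y) = ℕ.≤-antisym x≤y (ℕ.m∸n≡0⇒m≤n y∸x≡0)
      where
      n∣y∸x : n ∣ y ∸ x
      n∣y∸x = subst (n ∣_) (trans (cong ∣_∣ (ℤ.[+m]-[+n]≡m⊖n x y)) (ℤ.∣⊖∣-≤ x≤y)) (∣⇒∣ᵤ n∣x-y)
      y∸x≡0 : y ∸ x ≡ 0
      y∸x≡0 = ∣-<⇒≡0 n∣y∸x (ℕ.≤-<-trans (ℕ.m∸n≤m y x) y<n)

  <-mod-injective : ∀ {n x y} → x < n → y < n → + x ≡ + y mod n → x ≡ y
  <-mod-injective {x = x} {y} x<n y<n x≡y with ℕ.≤-total x y
  ... | inj₁ x≤y = ≤-<-mod-injective x≤y y<n x≡y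
  ... | inj₂ y≤x = sym (≤-<-mod-injective y≤x x<n (≡-mod-sym x≡y))

module Residues (n : ℕ) {{_ : NonZero n}} where

  open Congruence
  open import Data.Bool.Properties using (T-∧; T-∨)
  open import Data.Nat.Base as ℕ using (suc)
  import Data.Nat.Properties as ℕ
  open import Data.Nat.Divisibility using (∣-refl)
  open import Data.Integer.Base as ℤ using (ℤ; +_; _+_; _-_; 0ℤ; 1ℤ)
  import Data.Integer.Properties as ℤ
  open import Data.Integer.DivMod using (_/ℕ_; _%ℕ_; n%ℕd<d; a≡a%ℕn+[a/ℕn]*n)
  open import Data.Integer.Divisibility.Signed using (divides)
  open import Data.Integer.Tactic.RingSolver using (solve-∀)
  open import Data.Fin.Base using (Fin; toℕ; fromℕ<)
  open import Data.Fin.Properties using (toℕ<n; toℕ-fromℕ<; toℕ-injective)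
  open import Data.Sum.Base using (inj₁; inj₂)
  open import Function.Bundles using (_⇔_; mk⇔; Equivalence)
  open import Relation.Binary.PropositionalEquality using (sym; trans; cong; module ≡-Reasoning)

  ⟦_⟧ : Fin n → ℤ
  ⟦ x ⟧ = + toℕ x

  ⟦⟧-mod-injective : ∀ {x y} → ⟦ x ⟧ ≡ ⟦ y ⟧ mod n → x ≡ y
  ⟦⟧-mod-injective {x} {y} x≡y = toℕ-injective (<-mod-injective (toℕ<n x) (toℕ<n y) x≡y)

  rotate : ℤ → Fin n → Fin n
  rotate i x = fromℕ< (n%ℕd<d (⟦ x ⟧ + i) n)

  ⟦rotate⟧ : ∀ i x → ⟦ rotate i x ⟧ ≡ ⟦ x ⟧ + i mod n
  ⟦rotate⟧ i x = ≡-mod-sym (mod∣ (divides q (begin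
    a - ⟦ rotate i x ⟧  ≡⟨ cong (λ r → a - + r) (toℕ-fromℕ< (n%ℕd<d a n)) ⟩
    a - r               ≡⟨ cong (_- r) (a≡a%ℕn+[a/ℕn]*n a n) ⟩
    r + q ℤ.* + n - r   ≡⟨ r+y-r≡y r (q ℤ.* + n) ⟩
    q ℤ.* + n           ∎)))
    where
    open ≡-Reasoning
    a = ⟦ x ⟧ + i
    q = a /ℕ n
    r = + (a %ℕ n)
    r+y-r≡y : ∀ r y → r + y - r ≡ y
    r+y-r≡y = solve-∀

  rotate-unique : ∀ {i x y} → ⟦ y ⟧ ≡ ⟦ x ⟧ + i mod n → y ≡ rotate i x
  rotate-unique {i} {x} y≡x+i = ⟦⟧-mod-injective (≡-mod-trans y≡x+i (≡-mod-sym (⟦rotate⟧ i x)))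

  rotate-≡0 : ∀ {i} x → i ≡ 0ℤ mod n → rotate i x ≡ x
  rotate-≡0 {i} x i≡0 = sym (rotate-unique {i} {x} (≡-mod-sym (begin
    ⟦ x ⟧ + i   ≈⟨ +-congˡ-mod ⟦ x ⟧ i≡0 ⟩
    ⟦ x ⟧ + 0ℤ  ≡⟨ ℤ.+-identityʳ ⟦ x ⟧ ⟩
    ⟦ x ⟧       ∎)))
    where open import Relation.Binary.Reasoning.Setoid (ℤ-mod n)

  cycle-edge⇔ : ∀ {a b} → Edge (cycle n) a b ⇔ ⟦ b ⟧ ≡ ⟦ a ⟧ + 1ℤ mod n
  cycle-edge⇔ {a} {b} = mk⇔ to from
    where
    open import Relation.Binary.Reasoning.Setoid (ℤ-mod n)
    n≡0-mod-n : + n ≡ 0ℤ mod n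
    n≡0-mod-n = ∣∣⇒≡0-mod ∣-refl
    a+1 : ⟦ a ⟧ + 1ℤ ≡ + suc (toℕ a)
    a+1 = cong +_ (ℕ.+-comm (toℕ a) 1)
    to : Edge (cycle n) a b → ⟦ b ⟧ ≡ ⟦ a ⟧ + 1ℤ mod n
    to e with Equivalence.to T-∨ e
    ... | inj₁ b≡a+1 = ≡-mod-reflexive (trans (cong +_ (ℕ.≡ᵇ⇒≡ _ _ b≡a+1)) (sym a+1))
    ... | inj₂ wrap with Equivalence.to T-∧ wrap
    ...   | a≡n-1 , b≡0 = begin
      ⟦ b ⟧          ≡⟨ cong +_ (ℕ.≡ᵇ⇒≡ _ _ b≡0) ⟩
      0ℤ             ≈⟨ ≡-mod-sym n≡0-mod-n ⟩
      + n            ≡⟨ cong +_ (trans (sym (ℕ.suc-pred n)) (cong suc (sym (ℕ.≡ᵇ⇒≡ _ _ a≡n-1)))) ⟩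
      + suc (toℕ a)  ≡⟨ a+1 ⟨
      ⟦ a ⟧ + 1ℤ     ∎
    from : ⟦ b ⟧ ≡ ⟦ a ⟧ + 1ℤ mod n → Edge (cycle n) a b
    from b≡a+1 with ℕ.m≤n⇒m<n∨m≡n (toℕ<n a)
    ... | inj₁ a+1<n = Equivalence.from T-∨ (inj₁ (ℕ.≡⇒≡ᵇ _ _
          (<-mod-injective (toℕ<n b) a+1<n (≡-mod-trans b≡a+1 (≡-mod-reflexive a+1)))))
    ... | inj₂ a+1≡n = Equivalence.from T-∨ (inj₂ (Equivalence.from T-∧
          (ℕ.≡⇒≡ᵇ _ _ (cong ℕ.pred a+1≡n) , ℕ.≡⇒≡ᵇ _ _ (<-mod-injective (toℕ<n b) (ℕ.>-nonZero⁻¹ n) b≡0))))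
      where
      b≡0 : ⟦ b ⟧ ≡ 0ℤ mod n
      b≡0 = begin
        ⟦ b ⟧          ≈⟨ b≡a+1 ⟩
        ⟦ a ⟧ + 1ℤ     ≡⟨ a+1 ⟩
        + suc (toℕ a)  ≡⟨ cong +_ a+1≡n ⟩
        + n            ≈⟨ n≡0-mod-n ⟩
        0ℤ             ∎

module OrientedWalks where

  open Congruence
  open import Data.Nat.Base using (zero; suc; _≤_; z≤n; s≤s)
  open import Data.Integer.Base as ℤ using (ℤ; +_; -[1+_]; _+_; _-_; -_; 0ℤ; 1ℤ; -1ℤ)
  import Data.Integer.Properties as ℤ
  open import Data.Integer.Tactic.RingSolver using (solve-∀)
  open import Data.Fin.Properties using (_≟_)
  open import Data.List.Base using (List; []; _∷_; _++_; [_])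
  open import Data.List.Membership.Propositional using (_∈_)
  open import Data.List.Relation.Unary.All as All using ([]; _∷_)
  import Data.List.Relation.Unary.All.Properties as All
  open import Data.List.Relation.Unary.Any using (here; there; any?)
  open import Data.List.Relation.Unary.AllPairs using ([]; _∷_)
  open import Data.List.Relation.Unary.Unique.Propositional using (Unique)
  open import Data.List.Relation.Binary.Permutation.Propositional
    using (_↭_; ↭-refl; ↭-prep; ↭-swap; ↭-sym; ↭⇒↭ₛ; module PermutationReasoning)
  open import Data.List.Relation.Binary.Permutation.Propositional.Properties using (∷↭∷ʳ; drop-∷)
  import Data.List.Relation.Binary.Permutation.Setoid.Properties as Permutationₛ
  open import Data.Product.Base using (∃₂)
  open import Relation.Nullary.Decidable using (yes; no)
  open import Relation.Binary.PropositionalEquality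
    using (_≢_; refl; sym; trans; cong; subst; setoid; module ≡-Reasoning)

  private
    Unique-++⁻ʳ : ∀ {A : Set} (xs : List A) {ys} → Unique (xs ++ ys) → Unique ys
    Unique-++⁻ʳ []       u       = u
    Unique-++⁻ʳ (x ∷ xs) (_ ∷ u) = Unique-++⁻ʳ xs u

    Unique-++-∈⇒∷ : ∀ {A : Set} (xs : List A) {ys x} → Unique (xs ++ ys) → x ∈ ys → Unique (x ∷ xs)
    Unique-++-∈⇒∷ []       u        x∈ys = [] ∷ []
    Unique-++-∈⇒∷ (y ∷ xs) {x = x} (y∉ ∷ u) x∈ys with Unique-++-∈⇒∷ xs u x∈ys
    ... | x∉xs ∷ xs! = (x≢y ∷ x∉xs) ∷ All.++⁻ˡ xs y∉ ∷ xs!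
      where
      x≢y : x ≢ y
      x≢y x≡y = All.lookup (All.++⁻ʳ xs y∉) x∈ys (sym x≡y)

  module _ {A : Digraph} where

    infixr 5 _++ʷ_
    _++ʷ_ : ∀ {a b c} → Walk A a b → Walk A b c → Walk A a c
    []       ++ʷ W₂ = W₂
    (e +∷ W₁) ++ʷ W₂ = e +∷ (W₁ ++ʷ W₂)
    (e -∷ W₁) ++ʷ W₂ = e -∷ (W₁ ++ʷ W₂)

    netLength-++ʷ : ∀ {a b c} (W₁ : Walk A a b) (W₂ : Walk A b c) →
                    netLength (W₁ ++ʷ W₂) ≡ netLength W₁ + netLength W₂
    netLength-++ʷ []        W₂ = sym (ℤ.+-identityˡ (netLength W₂))
    netLength-++ʷ (e +∷ W₁) W₂ =
      trans (cong (ℤ._+_ 1ℤ) (netLength-++ʷ W₁ W₂)) (sym (ℤ.+-assoc 1ℤ (netLength W₁) (netLength W₂)))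
    netLength-++ʷ (e -∷ W₁) W₂ =
      trans (cong (ℤ._+_ -1ℤ) (netLength-++ʷ W₁ W₂)) (sym (ℤ.+-assoc -1ℤ (netLength W₁) (netLength W₂)))

    startVertices-++ʷ : ∀ {a b c} (W₁ : Walk A a b) (W₂ : Walk A b c) →
                        startVertices (W₁ ++ʷ W₂) ≡ startVertices W₁ ++ startVertices W₂
    startVertices-++ʷ []        W₂ = refl
    startVertices-++ʷ (e +∷ W₁) W₂ = cong (_ ∷_) (startVertices-++ʷ W₁ W₂)
    startVertices-++ʷ (e -∷ W₁) W₂ = cong (_ ∷_) (startVertices-++ʷ W₁ W₂)

    reverseʷ : ∀ {a b} → Walk A a b → Walk A b a
    reverseʷ []       = []
    reverseʷ (e +∷ W) = reverseʷ W ++ʷ (e -∷ [])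
    reverseʷ (e -∷ W) = reverseʷ W ++ʷ (e +∷ [])

    netLength-reverseʷ : ∀ {a b} (W : Walk A a b) → netLength (reverseʷ W) ≡ - netLength W
    netLength-reverseʷ []       = refl
    netLength-reverseʷ (e +∷ W) = begin
      netLength (reverseʷ W ++ʷ (e -∷ []))  ≡⟨ netLength-++ʷ (reverseʷ W) (e -∷ []) ⟩
      netLength (reverseʷ W) + -1ℤ         ≡⟨ cong (_+ -1ℤ) (netLength-reverseʷ W) ⟩
      - netLength W + -1ℤ                  ≡⟨ -i+-1≡-[1+i] (netLength W) ⟩
      - (1ℤ + netLength W)                 ∎
      where
      open ≡-Reasoning
      -i+-1≡-[1+i] : ∀ i → - i + -1ℤ ≡ - (1ℤ + i)
      -i+-1≡-[1+i] = solve-∀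
    netLength-reverseʷ (e -∷ W) = begin
      netLength (reverseʷ W ++ʷ (e +∷ []))  ≡⟨ netLength-++ʷ (reverseʷ W) (e +∷ []) ⟩
      netLength (reverseʷ W) + 1ℤ          ≡⟨ cong (_+ 1ℤ) (netLength-reverseʷ W) ⟩
      - netLength W + 1ℤ                   ≡⟨ -i+1≡-[-1+i] (netLength W) ⟩
      - (-1ℤ + netLength W)                ∎
      where
      open ≡-Reasoning
      -i+1≡-[-1+i] : ∀ i → - i + 1ℤ ≡ - (-1ℤ + i)
      -i+1≡-[-1+i] = solve-∀

    startVertices-reverseʷ : ∀ {a b} (W : Walk A a b) →
                             a ∷ startVertices (reverseʷ W) ↭ b ∷ startVertices W
    startVertices-reverseʷ []                         = ↭-refl
    startVertices-reverseʷ {a} {b} (_+∷_ {b = a′} e W) = begin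
      a ∷ startVertices (reverseʷ W ++ʷ (e -∷ []))  ≡⟨ cong (a ∷_) (startVertices-++ʷ (reverseʷ W) (e -∷ [])) ⟩
      a ∷ (startVertices (reverseʷ W) ++ [ a′ ])    ↭⟨ ↭-prep a (∷↭∷ʳ a′ _) ⟨
      a ∷ a′ ∷ startVertices (reverseʷ W)           ↭⟨ ↭-prep a (startVertices-reverseʷ W) ⟩
      a ∷ b ∷ startVertices W                       ↭⟨ ↭-swap a b ↭-refl ⟩
      b ∷ a ∷ startVertices W                       ∎
      where open PermutationReasoning
    startVertices-reverseʷ {a} {b} (_-∷_ {b = a′} e W) = begin
      a ∷ startVertices (reverseʷ W ++ʷ (e +∷ []))  ≡⟨ cong (a ∷_) (startVertices-++ʷ (reverseʷ W) (e +∷ [])) ⟩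
      a ∷ (startVertices (reverseʷ W) ++ [ a′ ])    ↭⟨ ↭-prep a (∷↭∷ʳ a′ _) ⟨
      a ∷ a′ ∷ startVertices (reverseʷ W)           ↭⟨ ↭-prep a (startVertices-reverseʷ W) ⟩
      a ∷ b ∷ startVertices W                       ↭⟨ ↭-swap a b ↭-refl ⟩
      b ∷ a ∷ startVertices W                       ∎
      where open PermutationReasoning

    Unique-reverseʷ : ∀ {a} (W : Walk A a a) → Unique (startVertices W) → Unique (startVertices (reverseʷ W))
    Unique-reverseʷ W =
      Permutationₛ.Unique-resp-↭ (setoid _) (↭⇒↭ₛ (↭-sym (drop-∷ (startVertices-reverseʷ W))))

    splitAt : ∀ {x a b} (W : Walk A a b) → x ∈ startVertices W →
              ∃₂ λ (W₁ : Walk A a x) (W₂ : Walk A x b) → W ≡ W₁ ++ʷ W₂ × x ∈ startVertices W₂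
    splitAt (e +∷ W) (here refl) = [] , e +∷ W , refl , here refl
    splitAt (e -∷ W) (here refl) = [] , e -∷ W , refl , here refl
    splitAt (e +∷ W) (there x∈W) with splitAt W x∈W
    ... | W₁ , W₂ , refl , x∈W₂ = e +∷ W₁ , W₂ , refl , x∈W₂
    splitAt (e -∷ W) (there x∈W) with splitAt W x∈W
    ... | W₁ , W₂ , refl , x∈W₂ = e -∷ W₁ , W₂ , refl , x∈W₂

    ++ʷ-assoc : ∀ {a b c e} (W₁ : Walk A a b) (W₂ : Walk A b c) (W₃ : Walk A c e) →
                (W₁ ++ʷ W₂) ++ʷ W₃ ≡ W₁ ++ʷ (W₂ ++ʷ W₃)
    ++ʷ-assoc []        W₂ W₃ = refl
    ++ʷ-assoc (e +∷ W₁) W₂ W₃ = cong (e +∷_) (++ʷ-assoc W₁ W₂ W₃)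
    ++ʷ-assoc (e -∷ W₁) W₂ W₃ = cong (e -∷_) (++ʷ-assoc W₁ W₂ W₃)

    startVertices≡∷⇒nonTrivial : ∀ {a b x xs} (W : Walk A a b) → startVertices W ≡ x ∷ xs → 1 ≤ steps W
    startVertices≡∷⇒nonTrivial (_ +∷ _) _ = s≤s z≤n
    startVertices≡∷⇒nonTrivial (_ -∷ _) _ = s≤s z≤n

    positive⇒nonTrivial : ∀ {a b k} (W : Walk A a b) → netLength W ≡ + suc k → 1 ≤ steps W
    positive⇒nonTrivial (_ +∷ _) _ = s≤s z≤n
    positive⇒nonTrivial (_ -∷ _) _ = s≤s z≤n

    module _ {d : ℕ} (cycle≡0 : ∀ (C : OrientedCycle A) → netLength (OrientedCycle.walk C) ≡ 0ℤ mod d) where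

      record PathReduction {a b} (W : Walk A a b) : Set where
        constructor reducesTo
        field
          path       : Walk A a b
          distinct   : Unique (startVertices path)
          netLength≡ : netLength W ≡ netLength path mod d

      private
        open import Relation.Binary.Reasoning.Setoid (ℤ-mod d)

        netLength-++ʷ-congʳ : ∀ {a b c} (S : Walk A a b) {W P : Walk A b c} →
                              netLength W ≡ netLength P mod d → netLength (S ++ʷ W) ≡ netLength (S ++ʷ P) mod d
        netLength-++ʷ-congʳ S {W} {P} W≡P = begin
          netLength (S ++ʷ W)        ≡⟨ netLength-++ʷ S W ⟩
          netLength S + netLength W  ≈⟨ +-congˡ-mod (netLength S) W≡P ⟩
          netLength S + netLength P  ≡⟨ netLength-++ʷ S P ⟨
          netLength (S ++ʷ P)        ∎

        -- If a already occurs on the path, the part of S ++ʷ P up to that occurrence is an oriented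
        -- cycle; its net length is ≡ 0, so it can be cut out.
        prependStep : ∀ {a a′ b} (S : Walk A a a′) → startVertices S ≡ [ a ] →
                      {W : Walk A a′ b} → PathReduction W → PathReduction (S ++ʷ W)
        prependStep {a} S sv[S] {W} (reducesTo P P! W≡P) with any? (a ≟_) (startVertices P)
        ... | no a∉P = reducesTo (S ++ʷ P) (subst Unique (sym sv[SP]) (All.¬Any⇒All¬ _ a∉P ∷ P!))
                         (netLength-++ʷ-congʳ S W≡P)
          where
          sv[SP] : startVertices (S ++ʷ P) ≡ a ∷ startVertices P
          sv[SP] = trans (startVertices-++ʷ S P) (cong (_++ startVertices P) sv[S])
        ... | yes a∈P with splitAt P a∈P
        ...   | Q₁ , Q₂ , refl , a∈Q₂ = reducesTo Q₂ (Unique-++⁻ʳ (startVertices Q₁) Q₁Q₂!) (begin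
          netLength (S ++ʷ W)                   ≈⟨ netLength-++ʷ-congʳ S W≡P ⟩
          netLength (S ++ʷ (Q₁ ++ʷ Q₂))         ≡⟨ cong netLength (++ʷ-assoc S Q₁ Q₂) ⟨
          netLength ((S ++ʷ Q₁) ++ʷ Q₂)         ≡⟨ netLength-++ʷ (S ++ʷ Q₁) Q₂ ⟩
          netLength (S ++ʷ Q₁) + netLength Q₂   ≈⟨ +-congʳ-mod (netLength Q₂) (cycle≡0 C) ⟩
          0ℤ + netLength Q₂                     ≡⟨ ℤ.+-identityˡ (netLength Q₂) ⟩
          netLength Q₂                          ∎)
          where
          Q₁Q₂! : Unique (startVertices Q₁ ++ startVertices Q₂)
          Q₁Q₂! = subst Unique (startVertices-++ʷ Q₁ Q₂) P!
          sv[SQ₁] : startVertices (S ++ʷ Q₁) ≡ a ∷ startVertices Q₁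
          sv[SQ₁] = trans (startVertices-++ʷ S Q₁) (cong (_++ startVertices Q₁) sv[S])
          C : OrientedCycle A
          C = record
            { base     = a
            ; walk     = S ++ʷ Q₁
            ; nonTriv  = startVertices≡∷⇒nonTrivial (S ++ʷ Q₁) sv[SQ₁]
            ; distinct = subst Unique (sym sv[SQ₁]) (Unique-++-∈⇒∷ (startVertices Q₁) Q₁Q₂! a∈Q₂)
            }

      reduceToPath : ∀ {a b} (W : Walk A a b) → PathReduction W
      reduceToPath []       = reducesTo [] [] (≡-mod-reflexive refl)
      reduceToPath (e +∷ W) = prependStep (e +∷ []) refl (reduceToPath W)
      reduceToPath (e -∷ W) = prependStep (e -∷ []) refl (reduceToPath W)

      closedPath≡0 : ∀ {a} (P : Walk A a a) → Unique (startVertices P) → netLength P ≡ 0ℤ mod d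
      closedPath≡0 []         _  = ≡-mod-reflexive refl
      closedPath≡0 P@(_ +∷ _) P! = cycle≡0 (record { walk = P ; nonTriv = s≤s z≤n ; distinct = P! })
      closedPath≡0 P@(_ -∷ _) P! = cycle≡0 (record { walk = P ; nonTriv = s≤s z≤n ; distinct = P! })

      closedWalk≡0 : ∀ {a} (W : Walk A a a) → netLength W ≡ 0ℤ mod d
      closedWalk≡0 W = let open PathReduction (reduceToPath W) in
        ≡-mod-trans netLength≡ (closedPath≡0 path distinct)

      netLength-mod-unique : ∀ {a b} (W W′ : Walk A a b) → netLength W ≡ netLength W′ mod d
      netLength-mod-unique W W′ =
        a-b≡0⇒a≡b (subst (_≡ 0ℤ mod d) netLength[W-W′] (closedWalk≡0 (W ++ʷ reverseʷ W′)))
        where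
        netLength[W-W′] : netLength (W ++ʷ reverseʷ W′) ≡ netLength W - netLength W′
        netLength[W-W′] =
          trans (netLength-++ʷ W (reverseʷ W′)) (cong (ℤ._+_ (netLength W)) (netLength-reverseʷ W′))

    cycle≡0-mod-γ : ∀ {g} → IsGamma A g → (C : OrientedCycle A) → netLength (OrientedCycle.walk C) ≡ 0ℤ mod g
    cycle≡0-mod-γ (γ∣cycles , _) C with netLength (OrientedCycle.walk C) in eq
    ... | + zero   = ≡-mod-reflexive refl
    ... | + suc k  = ∣∣⇒≡0-mod (γ∣cycles C k eq)
    ... | -[1+ k ] = ∣∣⇒≡0-mod (γ∣cycles C⁻¹ k C⁻¹-netLength)
      where
      open OrientedCycle C
      C⁻¹-netLength : netLength (reverseʷ walk) ≡ + suc k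
      C⁻¹-netLength = trans (netLength-reverseʷ walk) (cong -_ eq)
      C⁻¹ : OrientedCycle A
      C⁻¹ = record
        { base     = base
        ; walk     = reverseʷ walk
        ; nonTriv  = positive⇒nonTrivial (reverseʷ walk) C⁻¹-netLength
        ; distinct = Unique-reverseʷ walk distinct
        }

module Copies (m : ℕ) {{_ : NonZero m}} (H : Digraph) where

  open import Data.Bool.Properties using (T-∧)
  open import Data.Fin.Base using (Fin; combine; remQuot)
  open import Data.Fin.Properties using (combine-remQuot; remQuot-combine)
  open import Data.Product.Base using (proj₁; proj₂)
  open import Function.Bundles using (_⇔_; mk⇔; Equivalence)
  open import Relation.Nullary.Decidable using (toWitness; fromWitness)
  open import Relation.Binary.PropositionalEquality using (cong)
  open Equivalence using (to; from)

  copyOf : V (copies m H) → Fin m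
  copyOf z = proj₁ (remQuot {m} (size H) z)

  vertexOf : V (copies m H) → V H
  vertexOf z = proj₂ (remQuot {m} (size H) z)

  copies-edge⇔ : ∀ {x y} → Edge (copies m H) x y ⇔ (copyOf x ≡ copyOf y × Edge H (vertexOf x) (vertexOf y))
  copies-edge⇔ = mk⇔
    (λ e → let (same , e′) = to T-∧ e in toWitness same , e′)
    (λ (same , e′) → from T-∧ (fromWitness same , e′))

  combine-copyOf-vertexOf : ∀ z → combine (copyOf z) (vertexOf z) ≡ z
  combine-copyOf-vertexOf = combine-remQuot {m} (size H)

  copyOf-combine : ∀ i x → copyOf (combine i x) ≡ i
  copyOf-combine i x = cong proj₁ (remQuot-combine {m} {size H} i x)

  vertexOf-combine : ∀ i x → vertexOf (combine i x) ≡ x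
  vertexOf-combine i x = cong proj₂ (remQuot-combine {m} {size H} i x)

module HomsIntoCycles (A : Digraph) (m n : ℕ) {{_ : NonZero m}} {{_ : NonZero n}} where

  open Counting
  open Congruence
  open Residues n
  open OrientedWalks
  open Copies m (cycle n)
  open import Data.Nat.Base using (suc)
  open import Data.Integer.Base as ℤ using (ℤ; +_; _+_; 0ℤ; 1ℤ; -1ℤ)
  import Data.Integer.Properties as ℤ
  open import Data.Integer.Tactic.RingSolver using (solve-∀)
  open import Data.Fin.Base using (Fin; combine)
  open import Data.List.Base using (length)
  import Data.List.Properties as List
  import Data.List.Relation.Unary.All as All
  open import Data.Product.Base using (proj₁; proj₂)
  open import Function.Base using (_∘_)
  open import Function.Bundles using (_⇔_; mk⇔; Equivalence)
  open import Relation.Nullary.Negation using (¬_)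
  open import Relation.Binary.PropositionalEquality using (_≗_; refl; sym; trans; cong; cong₂; subst; subst₂)
  open import Relation.Binary.Reasoning.Setoid (ℤ-mod n)
  open Equivalence using (to; from)

  B : Digraph
  B = copies m (cycle n)

  B-edge⇔ : ∀ {x y} → Edge B x y ⇔ (copyOf x ≡ copyOf y × (⟦ vertexOf y ⟧ ≡ ⟦ vertexOf x ⟧ + 1ℤ mod n))
  B-edge⇔ = mk⇔
    (λ e → let (same , e′) = to copies-edge⇔ e in same , to cycle-edge⇔ e′)
    (λ (same , y≡x+1) → from copies-edge⇔ (same , from cycle-edge⇔ y≡x+1))

  rotateInCopy : ℤ → V B → V B
  rotateInCopy i z = combine (copyOf z) (rotate i (vertexOf z))

  rotateInCopy-≡0 : ∀ {i} z → i ≡ 0ℤ mod n → rotateInCopy i z ≡ z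
  rotateInCopy-≡0 z i≡0 =
    trans (cong (combine (copyOf z)) (rotate-≡0 (vertexOf z) i≡0)) (combine-copyOf-vertexOf z)

  rotateInCopy-edge : ∀ {i j} z → j ≡ i + 1ℤ mod n → Edge B (rotateInCopy i z) (rotateInCopy j z)
  rotateInCopy-edge {i} {j} z j≡i+1 = from B-edge⇔
    ( trans (copyOf-combine _ _) (sym (copyOf-combine _ _))
    , (begin
        ⟦ vertexOf (rotateInCopy j z) ⟧    ≡⟨ cong ⟦_⟧ (vertexOf-combine _ _) ⟩
        ⟦ rotate j x ⟧                     ≈⟨ ⟦rotate⟧ j x ⟩
        ⟦ x ⟧ + j                          ≈⟨ +-congˡ-mod ⟦ x ⟧ j≡i+1 ⟩
        ⟦ x ⟧ + (i + 1ℤ)                   ≡⟨ ℤ.+-assoc ⟦ x ⟧ i 1ℤ ⟨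
        ⟦ x ⟧ + i + 1ℤ                     ≈⟨ +-congʳ-mod 1ℤ (⟦rotate⟧ i x) ⟨
        ⟦ rotate i x ⟧ + 1ℤ                ≡⟨ cong (λ y → ⟦ y ⟧ + 1ℤ) (vertexOf-combine _ _) ⟨
        ⟦ vertexOf (rotateInCopy i z) ⟧ + 1ℤ ∎))
    where x = vertexOf z

  module _ {f : V A → V B} (f-hom : IsHom A B f) where

    hom-walk : ∀ {u v} (W : Walk A u v) →
               copyOf (f u) ≡ copyOf (f v) × (⟦ vertexOf (f v) ⟧ ≡ ⟦ vertexOf (f u) ⟧ + netLength W mod n)
    hom-walk {u} []     = refl , ≡-mod-reflexive (sym (ℤ.+-identityʳ ⟦ vertexOf (f u) ⟧))
    hom-walk {u} {v} (_+∷_ {b = b} e W) with to B-edge⇔ (f-hom _ _ e) | hom-walk W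
    ... | u~b , b≡u+1 | b~v , v≡b+W = trans u~b b~v , (begin
      ⟦ vertexOf (f v) ⟧                        ≈⟨ v≡b+W ⟩
      ⟦ vertexOf (f b) ⟧ + netLength W          ≈⟨ +-congʳ-mod (netLength W) b≡u+1 ⟩
      ⟦ vertexOf (f u) ⟧ + 1ℤ + netLength W     ≡⟨ ℤ.+-assoc ⟦ vertexOf (f u) ⟧ 1ℤ (netLength W) ⟩
      ⟦ vertexOf (f u) ⟧ + (1ℤ + netLength W)   ∎)
    hom-walk {u} {v} (_-∷_ {b = b} e W) with to B-edge⇔ (f-hom _ _ e) | hom-walk W
    ... | b~u , u≡b+1 | b~v , v≡b+W = trans (sym b~u) b~v , (begin
      ⟦ vertexOf (f v) ⟧                                 ≈⟨ v≡b+W ⟩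
      ⟦ vertexOf (f b) ⟧ + netLength W                   ≡⟨ x+i≡x+1+[-1+i] ⟦ vertexOf (f b) ⟧ (netLength W) ⟩
      ⟦ vertexOf (f b) ⟧ + 1ℤ + (-1ℤ + netLength W)      ≈⟨ +-congʳ-mod (-1ℤ + netLength W) u≡b+1 ⟨
      ⟦ vertexOf (f u) ⟧ + (-1ℤ + netLength W)           ∎)
      where
      x+i≡x+1+[-1+i] : ∀ x i → x + i ≡ x + 1ℤ + (-1ℤ + i)
      x+i≡x+1+[-1+i] = solve-∀

    hom-rotateInCopy : ∀ {u v} (W : Walk A u v) → f v ≡ rotateInCopy (netLength W) (f u)
    hom-rotateInCopy {u} {v} W = let (u~v , v≡u+W) = hom-walk W in
      trans (sym (combine-copyOf-vertexOf (f v)))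
            (cong₂ combine (sym u~v) (rotate-unique {netLength W} {vertexOf (f u)} v≡u+W))

    hom⇒n∣γ : ∀ {g} → IsGamma A g → n ∣ g
    hom⇒n∣γ (_ , γ-greatest) = γ-greatest n n∣cycle
      where
      n∣cycle : ∀ (C : OrientedCycle A) k → netLength (OrientedCycle.walk C) ≡ + suc k → n ∣ suc k
      n∣cycle C k netLength≡ = ≡0-mod⇒∣ (+-cancelˡ-mod (subst (λ i → x ≡ x + i mod n) netLength≡ x≡x+C))
        where
        x = ⟦ vertexOf (f (OrientedCycle.base C)) ⟧
        x≡x+C = proj₂ (hom-walk (OrientedCycle.walk C))

  hom≡0 : ∀ {g} → IsGamma A g → n ∤ g → hom A B ≡ 0
  hom≡0 γ n∤g = cong length (List.filter-none (isHom? A B) (All.universal noHom (allFuns (size A) (size B))))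
    where
    noHom : ∀ f → ¬ IsHom A B f
    noHom f f-hom = n∤g (hom⇒n∣γ f-hom γ)

  module _ {g k} (γ : IsGamma A g) (n∣g : n ∣ g) (components : IsComponentCount A k) where

    private
      label : V A → Fin k
      label = proj₁ components

      representative : Fin k → V A
      representative i = proj₁ (proj₁ (proj₂ components) i)

      label-representative : ∀ i → label (representative i) ≡ i
      label-representative i = proj₂ (proj₁ (proj₂ components) i)

      connected⇔ : ∀ u v → (label u ≡ label v) ⇔ Connected A u v
      connected⇔ = proj₂ (proj₂ components)

      fromRepresentative : ∀ v → Walk A (representative (label v)) v
      fromRepresentative v = to (connected⇔ _ v) (label-representative (label v))

      netLength-unique : ∀ {a b} (W W′ : Walk A a b) → netLength W ≡ netLength W′ mod n
      netLength-unique = netLength-mod-unique (λ C → ≡-mod-∣ n∣g (cycle≡0-mod-γ γ C))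

    extend : (Fin k → V B) → V A → V B
    extend c v = rotateInCopy (netLength (fromRepresentative v)) (c (label v))

    extend-hom : ∀ c → IsHom A B (extend c)
    extend-hom c u v e =
      sameComponent (from (connected⇔ u v) (e +∷ [])) (fromRepresentative u) (fromRepresentative v)
      where
      sameComponent : ∀ {i j} → i ≡ j → (W₁ : Walk A (representative i) u) (W₂ : Walk A (representative j) v) →
                      Edge B (rotateInCopy (netLength W₁) (c i)) (rotateInCopy (netLength W₂) (c j))
      sameComponent refl W₁ W₂ = rotateInCopy-edge {netLength W₁} {netLength W₂} (c _) (begin
        netLength W₂                  ≈⟨ netLength-unique W₂ (W₁ ++ʷ (e +∷ [])) ⟩
        netLength (W₁ ++ʷ (e +∷ []))  ≡⟨ netLength-++ʷ W₁ (e +∷ []) ⟩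
        netLength W₁ + 1ℤ             ∎)

    extend-representative : ∀ c i → extend c (representative i) ≡ c i
    extend-representative c i = closed (label-representative i) (fromRepresentative (representative i))
      where
      closed : ∀ {j} → j ≡ i → (W : Walk A (representative j) (representative i)) →
               rotateInCopy (netLength W) (c j) ≡ c i
      closed refl W = rotateInCopy-≡0 {netLength W} (c i) (netLength-unique W [])

    hom≡extend : ∀ {f} → IsHom A B f → f ≗ extend (f ∘ representative)
    hom≡extend f-hom v = hom-rotateInCopy f-hom (fromRepresentative v)

    hom≡[mn]^k : hom A B ≡ (m * n) ^ k
    hom≡[mn]^k = length-filter-parametrised (isHom? A B) representative extend
      (λ f≗g f-hom u v e → subst₂ (Edge B) (f≗g u) (f≗g v) (f-hom u v e))
      (λ c≗d v → cong (rotateInCopy (netLength (fromRepresentative v))) (c≗d (label v)))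
      extend-hom
      extend-representative
      hom≡extend


lemma12 : (A : Digraph) (m n : ℕ) {{_ : NonZero m}} {{_ : NonZero n}}
          (g k : ℕ) → IsGamma A g → IsComponentCount A k →
          (n ∤ g → hom A (copies m (cycle n)) ≡ 0)
          × (n ∣ g → hom A (copies m (cycle n)) ≡ (m * n) ^ k)
lemma12 A m n g k γ components = hom≡0 γ , λ n∣g → hom≡[mn]^k γ n∣g components
  where open HomsIntoCycles A m n
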